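{- For every positive integer $n$, the map $\varphi: B\mapsto (w_1(B),w_2(B))$, where $w_1(B)$ is drawn as a path starting at $(0,1)$ and $w_2(B)$ as a path starting at $(1,0)$, is a bijection from the set of binary trees with $n$ vertices onto the set of pairs of non-intersecting lattice paths of size $n$.
   Context: A binary tree is a finite nonempty rooted tree in which each vertex has at most one left child and at most one right child. For such a tree $B$, let $B_c$ be obtained by giving each vertex of $B$ a new leaf in place of each missing child. Perform the depth-first traversal of $B_c$ from the root, exploring left subtrees before right subtrees, and build a word $w(B)$ over $\{L_\ell,L_r,E_\ell,E_r\}$: each time a leaf of $B_c$ that is a left (resp. right) child is first reached, append $L_\ell$ (resp. $L_r$), except for the first and the last leaves reached, for which nothing is appended; each time an edge between two vertices of $B$ leading to a left (resp. right) child is first traversed, append $E_\ell$ (resp. $E_r$). $w_1(B)$ is obtained from $w(B)$ by deleting the letters $L_\ell,L_r$ and replacing $E_\ell$ by $N$ and $E_r$ by $E$; $w_2(B)$ is obtained by deleting $E_\ell,E_r$ and replacing $L_\ell$ by $E$ and $L_r$ by $N$. Words in $N,E$ are lattice paths with unit steps $N=(0,1)$, $E=(1,0)$. A pair of non-intersecting lattice paths of size $n$ is a pair of lattice paths with $N,E$ unit steps having no common point, starting at $(1,0)$ and $(0,1)$ and ending at $(n-i,i)$ and $(n-i-1,i+1)$ respectively, for some $i\in\{0,\dots,n-1\}$. -}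

module Defs where

open import Data.Nat using (ℕ; zero; suc; _+_; _∸_)
open import Data.Maybe using (Maybe; nothing; just)
open import Data.List using (List; []; _∷_; _++_; [_]; reverse)
open import Data.Product using (_×_; _,_)
open import Data.List.Membership.Propositional using (_∈_)
open import Relation.Binary.PropositionalEquality using (_≡_)
open import Data.Empty using (⊥)

data BinTree : Set where
  node : Maybe BinTree → Maybe BinTree → BinTree

mutual
  size : BinTree → ℕ
  size (node l r) = suc (msize l + msize r)

  msize : Maybe BinTree → ℕ
  msize nothing  = 0
  msize (just t) = size t

data Letter : Set where
  Lℓ Lr Eℓ Er : Letter

-- Full depth-first word of B_c, recording every added leaf (including the
-- first and the last one) and every edge of B, left before right.
mutual
  fullWord : BinTree → List Letter
  fullWord (node l r) = side Eℓ Lℓ l ++ side Er Lr r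

  side : Letter → Letter → Maybe BinTree → List Letter
  side e lf nothing  = [ lf ]
  side e lf (just t) = e ∷ fullWord t

dropFirstLeaf : List Letter → List Letter
dropFirstLeaf []        = []
dropFirstLeaf (Lℓ ∷ xs) = xs
dropFirstLeaf (Lr ∷ xs) = xs
dropFirstLeaf (Eℓ ∷ xs) = Eℓ ∷ dropFirstLeaf xs
dropFirstLeaf (Er ∷ xs) = Er ∷ dropFirstLeaf xs

dropLastLeaf : List Letter → List Letter
dropLastLeaf xs = reverse (dropFirstLeaf (reverse xs))

-- w(B): nothing is appended for the first and the last leaves reached
w : BinTree → List Letter
w B = dropLastLeaf (dropFirstLeaf (fullWord B))

data Step : Set where
  N E : Step

w₁ : BinTree → List Step
w₁ B = go (w B)
  where
  go : List Letter → List Step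
  go []        = []
  go (Eℓ ∷ xs) = N ∷ go xs
  go (Er ∷ xs) = E ∷ go xs
  go (Lℓ ∷ xs) = go xs
  go (Lr ∷ xs) = go xs

w₂ : BinTree → List Step
w₂ B = go (w B)
  where
  go : List Letter → List Step
  go []        = []
  go (Lℓ ∷ xs) = E ∷ go xs
  go (Lr ∷ xs) = N ∷ go xs
  go (Eℓ ∷ xs) = go xs
  go (Er ∷ xs) = go xs

Point : Set
Point = ℕ × ℕ

move : Point → Step → Point
move (x , y) N = (x , suc y)
move (x , y) E = (suc x , y)

points : Point → List Step → List Point
points p []       = p ∷ []
points p (s ∷ ss) = p ∷ points (move p s) ss

endPoint : Point → List Step → Point
endPoint p []       = p
endPoint p (s ∷ ss) = endPoint (move p s) ss

record NILP (n : ℕ) (P Q : List Step) : Set where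
  field
    i        : ℕ
    i<n      : suc i Data.Nat.≤ n
    endP     : endPoint (1 , 0) P ≡ (n ∸ i , i)
    endQ     : endPoint (0 , 1) Q ≡ (n ∸ i ∸ 1 , suc i)
    disjoint : ∀ (p : Point) → p ∈ points (1 , 0) P → p ∈ points (0 , 1) Q → ⊥

-- w₂(B) lists the inner leaves of B_c and w₁(B) the edges of B, so both satisfy a
-- recursion over the root: with left subtree a and right subtree b,
--   w₂ B = w₂ a · N · E · w₂ b   and   w₁ B = N · w₁ a · E · w₁ b
-- (the factors belonging to a missing subtree are dropped). Drawn from (1,0) and (0,1), the
-- two paths stay on a common antidiagonal x + y = const, so they are non-intersecting with the
-- required endpoints exactly when their distance along that antidiagonal never reaches 0 and
-- ends at 1.
-- Such pairs decompose uniquely at the first return of the distance to its initial value, and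
-- this decomposition is the recursion above read backwards; it gives the inverse of φ.

module Submission where

open import Defs
open import Data.Nat using (ℕ; zero; suc; _+_; _∸_; _≤_; _<_; z≤n; s≤s)
open import Data.Nat.Properties
  using (≤-refl; ≤-trans; ≤-pred; n≤1+n; m≤n+m; +-suc; +-comm; +-identityʳ; +-cancelʳ-≡;
         m+n∸n≡m; m∸n+n≡m; suc-injective; <-≤-trans; <-irrefl; +-assoc; m≢1+n+m)
open import Data.Maybe using (Maybe; nothing; just; maybe′)
open import Function using (id)
open import Data.Product using (_×_; Σ; _,_; proj₁; proj₂)
open import Data.List using (List; []; _∷_; _++_; [_]; reverse; length; drop; mapMaybe)
open import Data.List.Properties
  using (∷-injectiveʳ; ++-cancelˡ; length-++; reverse-++; reverse-involutive; ++-assoc;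
         ++-identityʳ; unfold-reverse; mapMaybe-++; length-++-≤ʳ)
open import Data.List.Membership.Propositional using (_∈_)
open import Data.List.Relation.Unary.Any using (here; there)
open import Data.Empty using (⊥; ⊥-elim)
open import Relation.Binary.PropositionalEquality
  using (_≡_; _≢_; refl; sym; trans; cong; cong₂; subst; subst₂; _≗_; module ≡-Reasoning)

open ≡-Reasoning

mapMaybe-reverse : ∀ {A B : Set} (f : A → Maybe B) xs →
  mapMaybe f (reverse xs) ≡ reverse (mapMaybe f xs)
mapMaybe-reverse f []       = refl
mapMaybe-reverse f (x ∷ xs) = begin
  mapMaybe f (reverse (x ∷ xs))
    ≡⟨ cong (mapMaybe f) (unfold-reverse x xs) ⟩
  mapMaybe f (reverse xs ++ [ x ])
    ≡⟨ mapMaybe-++ f (reverse xs) [ x ] ⟩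
  mapMaybe f (reverse xs) ++ mapMaybe f [ x ]
    ≡⟨ cong (_++ mapMaybe f [ x ]) (mapMaybe-reverse f xs) ⟩
  reverse (mapMaybe f xs) ++ mapMaybe f [ x ]
    ≡⟨ snoc-maybe (f x) (mapMaybe f xs) ⟩
  reverse (mapMaybe f (x ∷ xs)) ∎
  where
  snoc-maybe : ∀ {B : Set} (m : Maybe B) ys →
    reverse ys ++ maybe′ _∷_ id m [] ≡ reverse (maybe′ _∷_ id m ys)
  snoc-maybe nothing  ys = ++-identityʳ (reverse ys)
  snoc-maybe (just y) ys = sym (unfold-reverse y ys)

-- The words w₁ and w₂ as recursions over the tree

edgeStep : Letter → Maybe Step
edgeStep Eℓ = just N
edgeStep Er = just E
edgeStep Lℓ = nothing
edgeStep Lr = nothing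

leafStep : Letter → Maybe Step
leafStep Lℓ = just E
leafStep Lr = just N
leafStep Eℓ = nothing
leafStep Er = nothing

-- w₁ and w₂ are defined through anonymous where-bound functions; solving the metavariable
-- w₁-go (resp. w₂-go) by unification gives them a name, so they can be reasoned about.
mutual
  w₁-go : BinTree → List Letter → List Step
  w₁-go = _

  w₁-unfold : ∀ t → w₁ t ≡ w₁-go t (w t)
  w₁-unfold t with w t
  ... | ys = refl

mutual
  w₂-go : BinTree → List Letter → List Step
  w₂-go = _

  w₂-unfold : ∀ t → w₂ t ≡ w₂-go t (w t)
  w₂-unfold t with w t
  ... | ys = refl

w₁-go≗edgeSteps : ∀ t → w₁-go t ≗ mapMaybe edgeStep
w₁-go≗edgeSteps t []        = refl
w₁-go≗edgeSteps t (Eℓ ∷ ys) = cong (N ∷_) (w₁-go≗edgeSteps t ys)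
w₁-go≗edgeSteps t (Er ∷ ys) = cong (E ∷_) (w₁-go≗edgeSteps t ys)
w₁-go≗edgeSteps t (Lℓ ∷ ys) = w₁-go≗edgeSteps t ys
w₁-go≗edgeSteps t (Lr ∷ ys) = w₁-go≗edgeSteps t ys

w₂-go≗leafSteps : ∀ t → w₂-go t ≗ mapMaybe leafStep
w₂-go≗leafSteps t []        = refl
w₂-go≗leafSteps t (Lℓ ∷ ys) = cong (E ∷_) (w₂-go≗leafSteps t ys)
w₂-go≗leafSteps t (Lr ∷ ys) = cong (N ∷_) (w₂-go≗leafSteps t ys)
w₂-go≗leafSteps t (Eℓ ∷ ys) = w₂-go≗leafSteps t ys
w₂-go≗leafSteps t (Er ∷ ys) = w₂-go≗leafSteps t ys

edgeSteps-dropFirstLeaf : ∀ xs → mapMaybe edgeStep (dropFirstLeaf xs) ≡ mapMaybe edgeStep xs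
edgeSteps-dropFirstLeaf []        = refl
edgeSteps-dropFirstLeaf (Lℓ ∷ xs) = refl
edgeSteps-dropFirstLeaf (Lr ∷ xs) = refl
edgeSteps-dropFirstLeaf (Eℓ ∷ xs) = cong (N ∷_) (edgeSteps-dropFirstLeaf xs)
edgeSteps-dropFirstLeaf (Er ∷ xs) = cong (E ∷_) (edgeSteps-dropFirstLeaf xs)

leafSteps-dropFirstLeaf : ∀ xs → mapMaybe leafStep (dropFirstLeaf xs) ≡ drop 1 (mapMaybe leafStep xs)
leafSteps-dropFirstLeaf []        = refl
leafSteps-dropFirstLeaf (Lℓ ∷ xs) = refl
leafSteps-dropFirstLeaf (Lr ∷ xs) = refl
leafSteps-dropFirstLeaf (Eℓ ∷ xs) = leafSteps-dropFirstLeaf xs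
leafSteps-dropFirstLeaf (Er ∷ xs) = leafSteps-dropFirstLeaf xs

w₁≡edgeSteps : ∀ t → w₁ t ≡ mapMaybe edgeStep (fullWord t)
w₁≡edgeSteps t = begin
  w₁ t
    ≡⟨ w₁-unfold t ⟩
  w₁-go t (reverse D)
    ≡⟨ w₁-go≗edgeSteps t (reverse D) ⟩
  edges (reverse D)
    ≡⟨ mapMaybe-reverse edgeStep D ⟩
  reverse (edges D)
    ≡⟨ cong reverse (edgeSteps-dropFirstLeaf (reverse (dropFirstLeaf F))) ⟩
  reverse (edges (reverse (dropFirstLeaf F)))
    ≡⟨ cong reverse (mapMaybe-reverse edgeStep (dropFirstLeaf F)) ⟩
  reverse (reverse (edges (dropFirstLeaf F)))
    ≡⟨ reverse-involutive (edges (dropFirstLeaf F)) ⟩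
  edges (dropFirstLeaf F)
    ≡⟨ edgeSteps-dropFirstLeaf F ⟩
  edges F ∎
  where
  F D : List Letter
  F = fullWord t
  D = dropFirstLeaf (reverse (dropFirstLeaf F))
  edges : List Letter → List Step
  edges = mapMaybe edgeStep

w₂≡leafSteps : ∀ t → w₂ t ≡ reverse (drop 1 (reverse (drop 1 (mapMaybe leafStep (fullWord t)))))
w₂≡leafSteps t = begin
  w₂ t
    ≡⟨ w₂-unfold t ⟩
  w₂-go t (reverse D)
    ≡⟨ w₂-go≗leafSteps t (reverse D) ⟩
  leaves (reverse D)
    ≡⟨ mapMaybe-reverse leafStep D ⟩
  reverse (leaves D)
    ≡⟨ cong reverse (leafSteps-dropFirstLeaf (reverse (dropFirstLeaf F))) ⟩
  reverse (drop 1 (leaves (reverse (dropFirstLeaf F))))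
    ≡⟨ cong (λ z → reverse (drop 1 z)) (mapMaybe-reverse leafStep (dropFirstLeaf F)) ⟩
  reverse (drop 1 (reverse (leaves (dropFirstLeaf F))))
    ≡⟨ cong (λ z → reverse (drop 1 (reverse z))) (leafSteps-dropFirstLeaf F) ⟩
  reverse (drop 1 (reverse (drop 1 (leaves F)))) ∎
  where
  F D : List Letter
  F = fullWord t
  D = dropFirstLeaf (reverse (dropFirstLeaf F))
  leaves : List Letter → List Step
  leaves = mapMaybe leafStep

mutual
  lower : BinTree → List Step
  lower (node nothing  r) = lowerRight r
  lower (node (just a) r) = lower a ++ N ∷ lowerRight r

  lowerRight : Maybe BinTree → List Step
  lowerRight nothing  = []
  lowerRight (just b) = E ∷ lower b

mutual
  upper : BinTree → List Step
  upper (node nothing  r) = upperRight r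
  upper (node (just a) r) = N ∷ upper a ++ upperRight r

  upperRight : Maybe BinTree → List Step
  upperRight nothing  = []
  upperRight (just b) = E ∷ upper b

mutual
  edgeSteps-fullWord : ∀ t → mapMaybe edgeStep (fullWord t) ≡ upper t
  edgeSteps-fullWord (node nothing  r) = edgeSteps-right r
  edgeSteps-fullWord (node (just a) r) = cong (N ∷_) (begin
    mapMaybe edgeStep (fullWord a ++ side Er Lr r)
      ≡⟨ mapMaybe-++ edgeStep (fullWord a) (side Er Lr r) ⟩
    mapMaybe edgeStep (fullWord a) ++ mapMaybe edgeStep (side Er Lr r)
      ≡⟨ cong₂ _++_ (edgeSteps-fullWord a) (edgeSteps-right r) ⟩
    upper a ++ upperRight r ∎)

  edgeSteps-right : ∀ r → mapMaybe edgeStep (side Er Lr r) ≡ upperRight r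
  edgeSteps-right nothing  = refl
  edgeSteps-right (just b) = cong (E ∷_) (edgeSteps-fullWord b)

mutual
  leafSteps-fullWord : ∀ t → mapMaybe leafStep (fullWord t) ≡ E ∷ lower t ++ [ N ]
  leafSteps-fullWord (node nothing  r) = cong (E ∷_) (leafSteps-right r)
  leafSteps-fullWord (node (just a) r) = begin
    mapMaybe leafStep (fullWord a ++ side Er Lr r)
      ≡⟨ mapMaybe-++ leafStep (fullWord a) (side Er Lr r) ⟩
    mapMaybe leafStep (fullWord a) ++ mapMaybe leafStep (side Er Lr r)
      ≡⟨ cong₂ _++_ (leafSteps-fullWord a) (leafSteps-right r) ⟩
    E ∷ (lower a ++ [ N ]) ++ lowerRight r ++ [ N ]
      ≡⟨ cong (E ∷_) (++-assoc (lower a) [ N ] (lowerRight r ++ [ N ])) ⟩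
    E ∷ lower a ++ N ∷ lowerRight r ++ [ N ]
      ≡⟨ cong (E ∷_) (sym (++-assoc (lower a) (N ∷ lowerRight r) [ N ])) ⟩
    E ∷ (lower a ++ N ∷ lowerRight r) ++ [ N ] ∎

  leafSteps-right : ∀ r → mapMaybe leafStep (side Er Lr r) ≡ lowerRight r ++ [ N ]
  leafSteps-right nothing  = refl
  leafSteps-right (just b) = leafSteps-fullWord b

w₁≡upper : ∀ t → w₁ t ≡ upper t
w₁≡upper t = trans (w₁≡edgeSteps t) (edgeSteps-fullWord t)

w₂≡lower : ∀ t → w₂ t ≡ lower t
w₂≡lower t = begin
  w₂ t
    ≡⟨ w₂≡leafSteps t ⟩
  reverse (drop 1 (reverse (drop 1 (mapMaybe leafStep (fullWord t)))))
    ≡⟨ cong (λ z → reverse (drop 1 (reverse (drop 1 z)))) (leafSteps-fullWord t) ⟩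
  reverse (drop 1 (reverse (lower t ++ [ N ])))
    ≡⟨ cong (λ z → reverse (drop 1 z)) (reverse-++ (lower t) [ N ]) ⟩
  reverse (reverse (lower t))
    ≡⟨ reverse-involutive (lower t) ⟩
  lower t ∎

-- Gap walks and their first-return decomposition

private variable
  h : ℕ
  P Q R S A B A′ B′ R′ S′ : List Step

-- Gap h P Q: drawing Q from a point h + 1 antidiagonal steps north-west of the start of P,
-- the two paths never meet and end one antidiagonal step apart.
data Gap : ℕ → List Step → List Step → Set where
  end    : Gap 0 [] []
  east   : Gap h P Q → Gap h (E ∷ P) (E ∷ Q)
  north  : Gap h P Q → Gap h (N ∷ P) (N ∷ Q)
  widen  : Gap (suc h) P Q → Gap h (E ∷ P) (N ∷ Q)
  narrow : Gap h P Q → Gap (suc h) (N ∷ P) (E ∷ Q)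

data RightGap : List Step → List Step → Set where
  none : RightGap [] []
  some : Gap 0 R S → RightGap (E ∷ R) (E ∷ S)

RightGap⇒Gap : RightGap R S → Gap 0 R S
RightGap⇒Gap none     = end
RightGap⇒Gap (some g) = east g

Gap-length : Gap h P Q → length P ≡ length Q
Gap-length end        = refl
Gap-length (east g)   = cong suc (Gap-length g)
Gap-length (north g)  = cong suc (Gap-length g)
Gap-length (widen g)  = cong suc (Gap-length g)
Gap-length (narrow g) = cong suc (Gap-length g)

eastCount : Step → ℕ
eastCount N = 0
eastCount E = 1

Gap-join : (x : Step) → Gap h P Q → Gap 0 R S → Gap (eastCount x + h) (P ++ N ∷ R) (x ∷ Q ++ S)
Gap-join N end        g′ = north g′
Gap-join E end        g′ = narrow g′
Gap-join N (east g)   g′ = widen (Gap-join E g g′)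
Gap-join E (east g)   g′ = east (Gap-join E g g′)
Gap-join N (north g)  g′ = north (Gap-join N g g′)
Gap-join E (north g)  g′ = narrow (Gap-join N g g′)
Gap-join N (widen g)  g′ = widen (Gap-join N g g′)
Gap-join E (widen g)  g′ = east (Gap-join N g g′)
Gap-join N (narrow g) g′ = north (Gap-join E g g′)
Gap-join E (narrow g) g′ = narrow (Gap-join E g g′)

mutual
  Gap-tree : ∀ t → Gap 0 (lower t) (upper t)
  Gap-tree (node nothing  r) = RightGap⇒Gap (RightGap-tree r)
  Gap-tree (node (just a) r) = Gap-join N (Gap-tree a) (RightGap⇒Gap (RightGap-tree r))

  RightGap-tree : ∀ r → RightGap (lowerRight r) (upperRight r)
  RightGap-tree nothing  = none
  RightGap-tree (just b) = some (Gap-tree b)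

mutual
  upper-length : ∀ t → suc (length (upper t)) ≡ size t
  upper-length (node nothing  r) = cong suc (upperRight-length r)
  upper-length (node (just a) r) = cong suc (begin
    suc (length (upper a ++ upperRight r))
      ≡⟨ cong suc (length-++ (upper a)) ⟩
    suc (length (upper a)) + length (upperRight r)
      ≡⟨ cong₂ _+_ (upper-length a) (upperRight-length r) ⟩
    size a + msize r ∎)

  upperRight-length : ∀ r → length (upperRight r) ≡ msize r
  upperRight-length nothing  = refl
  upperRight-length (just b) = upper-length b

record FirstReturn (h : ℕ) (P Q : List Step) : Set where
  constructor firstReturnAt
  field
    Pˡ Qˡ Pʳ Qʳ : List Step
    P≡         : P ≡ Pˡ ++ N ∷ Pʳ
    Q≡         : Q ≡ Qˡ ++ Qʳ
    gap        : Gap h Pˡ Qˡ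
    rightGap   : RightGap Pʳ Qʳ

FirstReturn-∷ : ∀ {h′} (p q : Step) → (∀ {A B} → Gap h′ A B → Gap h (p ∷ A) (q ∷ B)) →
  FirstReturn h′ P Q → FirstReturn h (p ∷ P) (q ∷ Q)
FirstReturn-∷ p q step (firstReturnAt Pˡ Qˡ Pʳ Qʳ refl refl g rg) =
  firstReturnAt (p ∷ Pˡ) (q ∷ Qˡ) Pʳ Qʳ refl refl (step g) rg

-- Undoes Gap-join x, splitting at the first return of the gap.
firstReturn : ∀ h x P Q → Gap (eastCount x + h) P (x ∷ Q) → FirstReturn h P Q
firstReturn zero    N (N ∷ P) []      (north end)       = firstReturnAt [] [] [] [] refl refl end none
firstReturn zero    E (N ∷ P) []      (narrow end)      = firstReturnAt [] [] [] [] refl refl end none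
firstReturn (suc h) N (N ∷ P) []      (north ())
firstReturn (suc h) E (N ∷ P) []      (narrow ())
firstReturn h       E (E ∷ P) []      (east ())
firstReturn h       N (E ∷ P) []      (widen ())
firstReturn zero    N (N ∷ P) (E ∷ Q) (north (east g))  = firstReturnAt [] [] P (E ∷ Q) refl refl end (some g)
firstReturn zero    E (N ∷ P) (E ∷ Q) (narrow (east g)) = firstReturnAt [] [] P (E ∷ Q) refl refl end (some g)
firstReturn h       E (E ∷ P) (E ∷ Q) (east g)   = FirstReturn-∷ E E east (firstReturn h E P Q g)
firstReturn h       N (E ∷ P) (E ∷ Q) (widen g)  = FirstReturn-∷ E E east (firstReturn h E P Q g)
firstReturn h       E (E ∷ P) (N ∷ Q) (east g)   = FirstReturn-∷ E N widen (firstReturn (suc h) N P Q g)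
firstReturn h       N (E ∷ P) (N ∷ Q) (widen g)  = FirstReturn-∷ E N widen (firstReturn (suc h) N P Q g)
firstReturn h       N (N ∷ P) (N ∷ Q) (north g)  = FirstReturn-∷ N N north (firstReturn h N P Q g)
firstReturn h       E (N ∷ P) (N ∷ Q) (narrow g) = FirstReturn-∷ N N north (firstReturn h N P Q g)
firstReturn (suc h) N (N ∷ P) (E ∷ Q) (north g)  = FirstReturn-∷ N E narrow (firstReturn h E P Q g)
firstReturn (suc h) E (N ∷ P) (E ∷ Q) (narrow g) = FirstReturn-∷ N E narrow (firstReturn h E P Q g)

-- A Gap-prefix cannot be extended past a return of the gap, since the following N step of P
-- against an E step (or the end) of Q would close it; so the first-return split is unique.
prefixes-unique : Gap h A B → Gap h A′ B′ → RightGap R S → RightGap R′ S′ →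
  A ++ N ∷ R ≡ A′ ++ N ∷ R′ → B ++ S ≡ B′ ++ S′ → A ≡ A′ × B ≡ B′
prefixes-unique end end _ _ _ _ = refl , refl
prefixes-unique end (east _)   _ _ () _
prefixes-unique end (widen _)  _ _ () _
prefixes-unique end (north _) none _ _ ()
prefixes-unique end (north _) (some _) _ _ ()
prefixes-unique (east _)  end _ _ () _
prefixes-unique (widen _) end _ _ () _
prefixes-unique (north _) end _ none _ ()
prefixes-unique (north _) end _ (some _) _ ()
prefixes-unique (east g) (east g′) rg rg′ eA eB
  with refl , refl ← prefixes-unique g g′ rg rg′ (∷-injectiveʳ eA) (∷-injectiveʳ eB) = refl , refl
prefixes-unique (east _) (north _)  _ _ () _
prefixes-unique (east _) (widen _)  _ _ _ ()
prefixes-unique (east _) (narrow _) _ _ () _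
prefixes-unique (north _) (east _) _ _ () _
prefixes-unique (north g) (north g′) rg rg′ eA eB
  with refl , refl ← prefixes-unique g g′ rg rg′ (∷-injectiveʳ eA) (∷-injectiveʳ eB) = refl , refl
prefixes-unique (north _) (widen _)  _ _ () _
prefixes-unique (north _) (narrow _) _ _ _ ()
prefixes-unique (widen _) (east _)  _ _ _ ()
prefixes-unique (widen _) (north _) _ _ () _
prefixes-unique (widen g) (widen g′) rg rg′ eA eB
  with refl , refl ← prefixes-unique g g′ rg rg′ (∷-injectiveʳ eA) (∷-injectiveʳ eB) = refl , refl
prefixes-unique (widen _) (narrow _) _ _ () _
prefixes-unique (narrow _) (east _)  _ _ () _
prefixes-unique (narrow _) (north _) _ _ _ ()
prefixes-unique (narrow _) (widen _) _ _ () _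
prefixes-unique (narrow g) (narrow g′) rg rg′ eA eB
  with refl , refl ← prefixes-unique g g′ rg rg′ (∷-injectiveʳ eA) (∷-injectiveʳ eB) = refl , refl

mutual
  lower-upper-injective : ∀ t t′ → lower t ≡ lower t′ → upper t ≡ upper t′ → t ≡ t′
  lower-upper-injective (node nothing r) (node nothing r′) eP eQ =
    cong (node nothing) (right-injective r r′ eP eQ)
  lower-upper-injective (node (just a) r) (node (just a′) r′) eP eQ
    with eA , eB ← prefixes-unique (Gap-tree a) (Gap-tree a′) (RightGap-tree r) (RightGap-tree r′)
                     eP (∷-injectiveʳ eQ)
    with refl ← lower-upper-injective a a′ eA eB =
    cong (node (just a)) (right-injective r r′
      (∷-injectiveʳ (++-cancelˡ (lower a) _ _ eP)) (++-cancelˡ (upper a) _ _ (∷-injectiveʳ eQ)))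
  lower-upper-injective (node nothing nothing)  (node (just _) _) _ ()
  lower-upper-injective (node nothing (just _)) (node (just _) _) _ ()
  lower-upper-injective (node (just _) _) (node nothing nothing)  _ ()
  lower-upper-injective (node (just _) _) (node nothing (just _)) _ ()

  right-injective : ∀ r r′ → lowerRight r ≡ lowerRight r′ → upperRight r ≡ upperRight r′ → r ≡ r′
  right-injective nothing  nothing   _  _  = refl
  right-injective nothing  (just _)  () _
  right-injective (just _) nothing   () _
  right-injective (just b) (just b′) eP eQ =
    cong just (lower-upper-injective b b′ (∷-injectiveʳ eP) (∷-injectiveʳ eQ))

Decodes : List Step → List Step → Set
Decodes P Q = Σ BinTree λ t → lower t ≡ P × upper t ≡ Q

length-<-++ : ∀ (A : List Step) x R → length A < length (A ++ x ∷ R)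
length-<-++ []      x R = s≤s z≤n
length-<-++ (_ ∷ A) x R = s≤s (length-<-++ A x R)

mutual
  decode : ∀ k → length P < k → Gap 0 P Q → Decodes P Q
  decode (suc k) _  end         = node nothing nothing , refl , refl
  decode (suc k) lt (east g)
    with b , refl , refl ← decode k (≤-pred lt) g = node nothing (just b) , refl , refl
  decode (suc k) lt g@(north _) = decodeNode k (≤-pred lt) g
  decode (suc k) lt g@(widen _) = decodeNode k (≤-pred lt) g

  decodeNode : ∀ k → length P ≤ k → Gap 0 P (N ∷ Q) → Decodes P (N ∷ Q)
  decodeNode k le g
    with firstReturnAt Pˡ Qˡ Pʳ Qʳ refl refl gˡ rg ← firstReturn 0 N _ _ g
    with a , refl , refl ← decode k (<-≤-trans (length-<-++ Pˡ N Pʳ) le) gˡ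
    with rg
  ... | none = node (just a) nothing , refl , refl
  ... | some {R} gʳ
    with b , refl , refl ← decode k (≤-trans (n≤1+n _) (≤-trans (length-++-≤ʳ (N ∷ E ∷ R) {Pˡ}) le)) gʳ
    = node (just a) (just b) , refl , refl

-- Geometry of a pair of paths

level : Point → ℕ
level (x , y) = x + y

level-move : ∀ p s → level (move p s) ≡ suc (level p)
level-move (x , y) N = +-suc x y
level-move (x , y) E = refl

level-points : ∀ {p t} L → t ∈ points p L → level p ≤ level t
level-points     []      (here refl) = ≤-refl
level-points     (_ ∷ L) (here refl) = ≤-refl
level-points {p} {t} (s ∷ L) (there t∈) =
  ≤-trans (n≤1+n (level p)) (subst (_≤ level t) (level-move p s) (level-points L t∈))

level-endPoint : ∀ p L → level (endPoint p L) ≡ level p + length L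
level-endPoint p []      = sym (+-identityʳ (level p))
level-endPoint p (s ∷ L) = begin
  level (endPoint (move p s) L)      ≡⟨ level-endPoint (move p s) L ⟩
  level (move p s) + length L        ≡⟨ cong (_+ length L) (level-move p s) ⟩
  suc (level p) + length L           ≡⟨ sym (+-suc (level p) (length L)) ⟩
  level p + suc (length L)           ∎

record Apart (h : ℕ) (p q : Point) : Set where
  constructor apart
  field
    x-apart : proj₁ p ≡ suc (h + proj₁ q)
    y-apart : proj₂ q ≡ suc (h + proj₂ p)

Apart-level : ∀ {p q} → Apart h p q → level p ≡ level q
Apart-level {h} {px , py} {qx , qy} (apart refl refl) = begin
  suc (h + qx) + py      ≡⟨ cong (λ z → suc (z + py)) (+-comm h qx) ⟩
  suc (qx + h + py)      ≡⟨ cong suc (+-assoc qx h py) ⟩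
  suc (qx + (h + py))    ≡⟨ sym (+-suc qx (h + py)) ⟩
  qx + suc (h + py)      ∎

Apart-≢ : ∀ {p q} → Apart h p q → p ≢ q
Apart-≢ {p = _ , _} {q = qx , _} (apart refl _) p≡q = m≢1+n+m qx (sym (cong proj₁ p≡q))

Disjoint : Point → Point → List Step → List Step → Set
Disjoint p q P Q = ∀ t → t ∈ points p P → t ∈ points q Q → ⊥

Disjoint-[] : ∀ {p q} → p ≢ q → Disjoint p q [] []
Disjoint-[] p≢q _ (here refl) (here refl) = p≢q refl

-- Both paths move up one level per step, so they can only meet after equally many steps.
Disjoint-∷ : ∀ {p q} a b → level p ≡ level q → p ≢ q →
  Disjoint (move p a) (move q b) P Q → Disjoint p q (a ∷ P) (b ∷ Q)
Disjoint-∷ a b lp≡lq p≢q _ _ (here refl) (here refl) = p≢q refl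
Disjoint-∷ {Q = Q} {p} {q} a b lp≡lq _ _ _ (here refl) (there t∈Q) =
  <-irrefl (sym lp≡lq) (subst (_≤ level p) (level-move q b) (level-points Q t∈Q))
Disjoint-∷ {P = P} {p = p} {q} a b lp≡lq _ _ _ (there t∈P) (here refl) =
  <-irrefl lp≡lq (subst (_≤ level q) (level-move p a) (level-points P t∈P))
Disjoint-∷ a b _ _ d t (there t∈P) (there t∈Q) = d t t∈P t∈Q

Apart-east : ∀ {p q} → Apart h p q → Apart h (move p E) (move q E)
Apart-east {h} {q = qx , _} (apart refl refl) = apart (cong suc (sym (+-suc h qx))) refl

Apart-north : ∀ {p q} → Apart h p q → Apart h (move p N) (move q N)
Apart-north {h} {p = _ , py} (apart refl refl) = apart refl (cong suc (sym (+-suc h py)))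

Apart-widen : ∀ {p q} → Apart h p q → Apart (suc h) (move p E) (move q N)
Apart-widen {p = _ , _} {q = _ , _} (apart refl refl) = apart refl refl

Apart-narrow : ∀ {p q} → Apart (suc h) p q → Apart h (move p N) (move q E)
Apart-narrow {h} {p = _ , py} {q = qx , _} (apart refl refl) =
  apart (cong suc (sym (+-suc h qx))) (cong suc (sym (+-suc h py)))

Apart-meet : ∀ {p q} → Apart 0 p q → move p N ≡ move q E
Apart-meet {p = _ , _} {q = _ , _} (apart refl refl) = refl

start∈points : ∀ p L → p ∈ points p L
start∈points p []      = here refl
start∈points p (_ ∷ _) = here refl

Gap⇒Disjoint : ∀ {p q} → Apart h p q → Gap h P Q → Disjoint p q P Q
Gap⇒Disjoint a end        = Disjoint-[] (Apart-≢ a)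
Gap⇒Disjoint a (east g)   = Disjoint-∷ E E (Apart-level a) (Apart-≢ a) (Gap⇒Disjoint (Apart-east a) g)
Gap⇒Disjoint a (north g)  = Disjoint-∷ N N (Apart-level a) (Apart-≢ a) (Gap⇒Disjoint (Apart-north a) g)
Gap⇒Disjoint a (widen g)  = Disjoint-∷ E N (Apart-level a) (Apart-≢ a) (Gap⇒Disjoint (Apart-widen a) g)
Gap⇒Disjoint a (narrow g) = Disjoint-∷ N E (Apart-level a) (Apart-≢ a) (Gap⇒Disjoint (Apart-narrow a) g)

Gap-endPoints : ∀ {p q} → Apart h p q → Gap h P Q → Apart 0 (endPoint p P) (endPoint q Q)
Gap-endPoints a end        = a
Gap-endPoints a (east g)   = Gap-endPoints (Apart-east a) g
Gap-endPoints a (north g)  = Gap-endPoints (Apart-north a) g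
Gap-endPoints a (widen g)  = Gap-endPoints (Apart-widen a) g
Gap-endPoints a (narrow g) = Gap-endPoints (Apart-narrow a) g

Disjoint-tail : ∀ {p q} a b → Disjoint p q (a ∷ P) (b ∷ Q) → Disjoint (move p a) (move q b) P Q
Disjoint-tail _ _ d t t∈P t∈Q = d t (there t∈P) (there t∈Q)

Disjoint⇒Gap : ∀ {p q} P Q → Apart h p q → length P ≡ length Q → Disjoint p q P Q →
  Apart 0 (endPoint p P) (endPoint q Q) → Gap h P Q
Disjoint⇒Gap {h} {p = _ , py} [] [] (apart _ refl) _ _ (apart _ qy≡) =
  subst (λ k → Gap k [] []) (sym (+-cancelʳ-≡ py h 0 (suc-injective qy≡))) end
Disjoint⇒Gap (E ∷ P) (E ∷ Q) a len d e =
  east (Disjoint⇒Gap P Q (Apart-east a) (suc-injective len) (Disjoint-tail E E d) e)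
Disjoint⇒Gap (N ∷ P) (N ∷ Q) a len d e =
  north (Disjoint⇒Gap P Q (Apart-north a) (suc-injective len) (Disjoint-tail N N d) e)
Disjoint⇒Gap (E ∷ P) (N ∷ Q) a len d e =
  widen (Disjoint⇒Gap P Q (Apart-widen a) (suc-injective len) (Disjoint-tail E N d) e)
Disjoint⇒Gap {suc h} (N ∷ P) (E ∷ Q) a len d e =
  narrow (Disjoint⇒Gap P Q (Apart-narrow a) (suc-injective len) (Disjoint-tail N E d) e)
Disjoint⇒Gap {zero} {p} {q} (N ∷ P) (E ∷ Q) a _ d _ =
  ⊥-elim (Disjoint-tail N E d (move q E)
    (subst (_∈ points (move p N) P) (Apart-meet a) (start∈points (move p N) P))
    (start∈points (move q E) Q))

-- Non-intersecting lattice paths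

n∸i≡1+[n∸i∸1] : ∀ {n i} → i < n → n ∸ i ≡ suc (n ∸ i ∸ 1)
n∸i≡1+[n∸i∸1] {suc n} {zero}  _         = refl
n∸i≡1+[n∸i∸1] {suc n} {suc i} (s≤s i<n) = n∸i≡1+[n∸i∸1] i<n

origin-apart : Apart 0 (1 , 0) (0 , 1)
origin-apart = apart refl refl

NILP-intro : Disjoint (1 , 0) (0 , 1) P Q → ∀ {e f} → endPoint (1 , 0) P ≡ e → endPoint (0 , 1) Q ≡ f →
  Apart 0 e f → NILP (level e) P Q
NILP-intro d {suc a , b} {a , suc b} eP eQ (apart refl refl) = record
  { i        = b
  ; i<n      = s≤s (m≤n+m b a)
  ; endP     = trans eP (cong (_, b) (sym a+1+b∸b))
  ; endQ     = trans eQ (cong (_, suc b) (sym (cong (_∸ 1) a+1+b∸b)))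
  ; disjoint = d
  }
  where
  a+1+b∸b : suc a + b ∸ b ≡ suc a
  a+1+b∸b = m+n∸n≡m (suc a) b

module _ {n P Q} (nilp : NILP n P Q) where
  open NILP nilp

  NILP-endPoints : Apart 0 (endPoint (1 , 0) P) (endPoint (0 , 1) Q)
  NILP-endPoints = subst₂ (Apart 0) (sym endP) (sym endQ) (apart (n∸i≡1+[n∸i∸1] i<n) refl)

  NILP-length : suc (length P) ≡ n
  NILP-length = begin
    suc (length P)                  ≡⟨ sym (level-endPoint (1 , 0) P) ⟩
    level (endPoint (1 , 0) P)      ≡⟨ cong level endP ⟩
    n ∸ i + i                       ≡⟨ m∸n+n≡m (≤-trans (n≤1+n i) i<n) ⟩
    n                               ∎

  NILP-Gap : Gap 0 P Q
  NILP-Gap = Disjoint⇒Gap P Q origin-apart (suc-injective (trans NILP-length (sym length-Q)))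
                          disjoint NILP-endPoints
    where
    length-Q : suc (length Q) ≡ n
    length-Q = begin
      suc (length Q)                  ≡⟨ sym (level-endPoint (0 , 1) Q) ⟩
      level (endPoint (0 , 1) Q)      ≡⟨ sym (Apart-level NILP-endPoints) ⟩
      level (endPoint (1 , 0) P)      ≡⟨ level-endPoint (1 , 0) P ⟩
      suc (length P)                  ≡⟨ NILP-length ⟩
      n                               ∎

tree-NILP : ∀ t → NILP (size t) (lower t) (upper t)
tree-NILP t = subst (λ n → NILP n (lower t) (upper t)) level≡size
  (NILP-intro (Gap⇒Disjoint origin-apart (Gap-tree t)) refl refl (Gap-endPoints origin-apart (Gap-tree t)))
  where
  level≡size : level (endPoint (1 , 0) (lower t)) ≡ size t
  level≡size = begin
    level (endPoint (1 , 0) (lower t))  ≡⟨ level-endPoint (1 , 0) (lower t) ⟩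
    suc (length (lower t))              ≡⟨ cong suc (Gap-length (Gap-tree t)) ⟩
    suc (length (upper t))              ≡⟨ upper-length t ⟩
    size t                              ∎

NILP-tree : ∀ {n} → NILP n P Q → Σ BinTree λ t → size t ≡ n × lower t ≡ P × upper t ≡ Q
NILP-tree {P} {n = n} nilp with t , refl , refl ← decode (suc (length P)) ≤-refl (NILP-Gap nilp) =
  t , size≡n , refl , refl
  where
  size≡n : size t ≡ n
  size≡n = begin
    size t                  ≡⟨ sym (upper-length t) ⟩
    suc (length (upper t))  ≡⟨ cong suc (sym (Gap-length (Gap-tree t))) ⟩
    suc (length (lower t))  ≡⟨ NILP-length nilp ⟩
    n                       ∎

proposition5p2 : (n : ℕ) → 1 ≤ n →
    ((B : BinTree) → size B ≡ n → NILP n (w₂ B) (w₁ B))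
    × ((B B′ : BinTree) → size B ≡ n → size B′ ≡ n →
         w₁ B ≡ w₁ B′ → w₂ B ≡ w₂ B′ → B ≡ B′)
    × ((P Q : List Step) → NILP n P Q →
         Σ BinTree (λ B → size B ≡ n × w₁ B ≡ Q × w₂ B ≡ P))
proposition5p2 n _ =
  (λ B → λ { refl → subst₂ (NILP (size B)) (sym (w₂≡lower B)) (sym (w₁≡upper B)) (tree-NILP B) }) ,
  (λ B B′ _ _ w₁≡ w₂≡ → lower-upper-injective B B′
     (trans (sym (w₂≡lower B)) (trans w₂≡ (w₂≡lower B′)))
     (trans (sym (w₁≡upper B)) (trans w₁≡ (w₁≡upper B′)))) ,
  λ P Q nilp → let t , size≡n , lower≡P , upper≡Q = NILP-tree nilp in
    t , size≡n , trans (w₁≡upper t) upper≡Q , trans (w₂≡lower t) lower≡P
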